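{- Let $P=\{2413,3412,3421\}$ and let $\pi$ be a simple $n$-permutation avoiding every pattern in $P$, with $n\geq 4$. Then $\pi_{n-1}=n$ and $\pi_1=n-1$.
   Context: An interval of an $n$-permutation $\pi$ is a factor $\pi_i\cdots\pi_j$ whose values form a set of consecutive integers; it is trivial if its length is $0$, $1$ or $n$. A permutation is simple if all its intervals are trivial. Pattern containment is the usual order-isomorphic subsequence containment. -}

module Defs where

open import Data.Nat using (ℕ; zero; suc; _+_; _∸_)
open import Data.Fin using (Fin; toℕ; _<_; _≤_; zero; suc)
open import Data.Product using (Σ; ∃; _×_; _,_)
open import Data.Sum using (_⊎_)
open import Data.Vec using (Vec; []; _∷_; lookup)
open import Data.Fin.Permutation using (Permutation′; _⟨$⟩ʳ_)
open import Relation.Binary.PropositionalEquality using (_≡_)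
open import Function.Bundles using (_⇔_)

-- An n-permutation, given as a bijection Fin n → Fin n.
-- Positions and values are 0-based: the paper's π_i is  π ⟨$⟩ʳ (i-1) + 1.
Perm : ℕ → Set
Perm n = Permutation′ n

IsInterval : ∀ {n} → Perm n → Fin n → Fin n → Set
IsInterval {n} π i j =
  ∀ (k₁ k₂ : Fin n) (v : Fin n) →
    i ≤ k₁ → k₁ ≤ j → i ≤ k₂ → k₂ ≤ j →
    (π ⟨$⟩ʳ k₁) ≤ v → v ≤ (π ⟨$⟩ʳ k₂) →
    Σ (Fin n) λ k → (i ≤ k) × (k ≤ j) × (π ⟨$⟩ʳ k ≡ v)

IsSimple : ∀ {n} → Perm n → Set
IsSimple {n} π =
  ∀ (i j : Fin n) → i ≤ j → IsInterval π i j →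
    (suc (toℕ j) ∸ toℕ i ≡ 1) ⊎ (suc (toℕ j) ∸ toℕ i ≡ n)

p2413 p3412 p3421 : Fin 4 → Fin 4
p2413 = lookup (suc zero ∷ suc (suc (suc zero)) ∷ zero ∷ suc (suc zero) ∷ [])
p3412 = lookup (suc (suc zero) ∷ suc (suc (suc zero)) ∷ zero ∷ suc zero ∷ [])
p3421 = lookup (suc (suc zero) ∷ suc (suc (suc zero)) ∷ suc zero ∷ zero ∷ [])

ContainsPat : ∀ {n k} → Perm n → (Fin k → Fin k) → Set
ContainsPat {n} {k} π σ =
  Σ (Fin k → Fin n) λ f →
    (∀ a b → a < b → f a < f b) ×
    (∀ a b → ((π ⟨$⟩ʳ f a) < (π ⟨$⟩ʳ f b)) ⇔ (σ a < σ b))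

-- Write m for the position of the largest entry n.  If m were 1 or n, the
-- remaining n - 1 entries would form a proper interval, so 1 < m < n and m is a
-- left-to-right maximum with π_n < π_m.  The key lemma: a left-to-right maximum q
-- with 1 < q < n and π_n < π_q sits at q = n - 1.  Let a = π_α be the largest entry
-- before q.  Two later entries below a would form 3412 or 3421 with π_α and π_q;
-- if π_n > a, a later entry below a would form 2413 with π_α, π_q and π_n.  Hence either
-- all of π_q ⋯ π_n exceed a, or exactly π_n lies below a and π_q ⋯ π_{n-1} are the
-- entries above a; the first is a proper interval and the second must be trivial.
-- Since then π_n < a < n, the entry n - 1 lies before m; were it not first, it
-- would be a left-to-right maximum placed at n - 1 = m by the same lemma.
module Submission where

open import Defs
open import Data.Nat as ℕ using (ℕ; zero; suc; z≤n; s≤s; _∸_; _≥_)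
import Data.Nat.Properties as ℕₚ
open import Data.Fin using (Fin; toℕ; zero; suc; inject; inject₁; fromℕ; fromℕ<; #_; _<_; _≤_)
import Data.Fin.Properties as Finₚ
open import Data.Vec using (_∷_; []; lookup)
open import Data.Product using (Σ; ∃; _,_; _×_; proj₁)
open import Data.Empty using (⊥)
open import Data.Sum using (_⊎_; inj₁; inj₂; [_,_])
open import Data.Fin.Permutation using (_⟨$⟩ʳ_; _⟨$⟩ˡ_; inverseˡ; inverseʳ)
open import Relation.Nullary using (¬_; yes; no; contradiction)
open import Function.Base using (_∘_)
open import Function.Bundles using (mk⇔)
open import Relation.Binary.Definitions using (tri<; tri≈; tri>)
open import Relation.Binary.PropositionalEquality
  using (_≡_; _≢_; refl; sym; trans; cong; subst; subst₂; module ≡-Reasoning)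

strictlyIncreasing : ∀ {k} (h : Fin (suc k) → ℕ) →
  (∀ i → h (inject₁ i) ℕ.< h (suc i)) → ∀ {a b} → a < b → h a ℕ.< h b
strictlyIncreasing {suc k} h step {zero} {suc zero} _ = step zero
strictlyIncreasing {suc k} h step {zero} {suc (suc b)} _ =
  ℕₚ.<-trans (step zero) (strictlyIncreasing (h ∘ suc) (step ∘ suc) {zero} {suc b} (s≤s z≤n))
strictlyIncreasing {suc k} h step {suc a} {suc b} (s≤s a<b) =
  strictlyIncreasing (h ∘ suc) (step ∘ suc) a<b

-- τ is the inverse of σ, so the chain lists the occurrence from its smallest to
-- its largest entry.
containsPat-byChain : ∀ {n k} (π : Perm n) (σ τ : Fin (suc k) → Fin (suc k)) →
  (∀ a → τ (σ a) ≡ a) → (f : Fin (suc k) → Fin n) →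
  (∀ i → f (inject₁ i) < f (suc i)) →
  (∀ v → π ⟨$⟩ʳ f (τ (inject₁ v)) < π ⟨$⟩ʳ f (τ (suc v))) →
  ContainsPat π σ
containsPat-byChain π σ τ τσ f f-steps chain =
  f , (λ _ _ → strictlyIncreasing (toℕ ∘ f) f-steps) , λ a b → mk⇔ (reflect a b) (preserve a b)
  where
  preserve : ∀ a b → σ a < σ b → π ⟨$⟩ʳ f a < π ⟨$⟩ʳ f b
  preserve a b σa<σb =
    subst₂ (λ x y → π ⟨$⟩ʳ f x < π ⟨$⟩ʳ f y) (τσ a) (τσ b)
      (strictlyIncreasing (λ v → toℕ (π ⟨$⟩ʳ f (τ v))) chain σa<σb)
  reflect : ∀ a b → π ⟨$⟩ʳ f a < π ⟨$⟩ʳ f b → σ a < σ b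
  reflect a b πa<πb with Finₚ.<-cmp (σ a) (σ b)
  ... | tri< σa<σb _ _ = σa<σb
  ... | tri≈ _ σa≡σb _ = contradiction πa<πb (Finₚ.<-irrefl (cong ((π ⟨$⟩ʳ_) ∘ f) a≡b))
    where
    a≡b : a ≡ b
    a≡b = trans (sym (τσ a)) (trans (cong τ σa≡σb) (τσ b))
  ... | tri> _ _ σb<σa = contradiction (preserve b a σb<σa) (Finₚ.<-asym πa<πb)

module _ {n} (π : Perm n) {i j k l : Fin n} (i<j : i < j) (j<k : j < k) (k<l : k < l) where

  private
    at : Fin 4 → Fin n
    at = lookup (i ∷ j ∷ k ∷ l ∷ [])

    at-increasing : ∀ p → at (inject₁ p) < at (suc p)
    at-increasing zero = i<j
    at-increasing (suc zero) = j<k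
    at-increasing (suc (suc zero)) = k<l

  contains2413 : π ⟨$⟩ʳ k < π ⟨$⟩ʳ i → π ⟨$⟩ʳ i < π ⟨$⟩ʳ l → π ⟨$⟩ʳ l < π ⟨$⟩ʳ j →
    ContainsPat π p2413
  contains2413 h₁ h₂ h₃ = containsPat-byChain π p2413 τ inverse at at-increasing
    λ { zero → h₁ ; (suc zero) → h₂ ; (suc (suc zero)) → h₃ }
    where
    τ : Fin 4 → Fin 4
    τ = lookup (# 2 ∷ # 0 ∷ # 3 ∷ # 1 ∷ [])
    inverse : ∀ a → τ (p2413 a) ≡ a
    inverse zero = refl
    inverse (suc zero) = refl
    inverse (suc (suc zero)) = refl
    inverse (suc (suc (suc zero))) = refl

  contains3412 : π ⟨$⟩ʳ k < π ⟨$⟩ʳ l → π ⟨$⟩ʳ l < π ⟨$⟩ʳ i → π ⟨$⟩ʳ i < π ⟨$⟩ʳ j →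
    ContainsPat π p3412
  contains3412 h₁ h₂ h₃ = containsPat-byChain π p3412 p3412 inverse at at-increasing
    λ { zero → h₁ ; (suc zero) → h₂ ; (suc (suc zero)) → h₃ }
    where
    inverse : ∀ a → p3412 (p3412 a) ≡ a
    inverse zero = refl
    inverse (suc zero) = refl
    inverse (suc (suc zero)) = refl
    inverse (suc (suc (suc zero))) = refl

  contains3421 : π ⟨$⟩ʳ l < π ⟨$⟩ʳ k → π ⟨$⟩ʳ k < π ⟨$⟩ʳ i → π ⟨$⟩ʳ i < π ⟨$⟩ʳ j →
    ContainsPat π p3421
  contains3421 h₁ h₂ h₃ = containsPat-byChain π p3421 τ inverse at at-increasing
    λ { zero → h₁ ; (suc zero) → h₂ ; (suc (suc zero)) → h₃ }
    where
    τ : Fin 4 → Fin 4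
    τ = lookup (# 3 ∷ # 2 ∷ # 0 ∷ # 1 ∷ [])
    inverse : ∀ a → τ (p3421 a) ≡ a
    inverse zero = refl
    inverse (suc zero) = refl
    inverse (suc (suc zero)) = refl
    inverse (suc (suc (suc zero))) = refl

module _ {n} (π : Perm n) where

  ⟨$⟩ʳ-injective : ∀ {k l} → π ⟨$⟩ʳ k ≡ π ⟨$⟩ʳ l → k ≡ l
  ⟨$⟩ʳ-injective {k} {l} πk≡πl = begin
    k                      ≡⟨ inverseˡ π ⟨
    π ⟨$⟩ˡ (π ⟨$⟩ʳ k)      ≡⟨ cong (π ⟨$⟩ˡ_) πk≡πl ⟩
    π ⟨$⟩ˡ (π ⟨$⟩ʳ l)      ≡⟨ inverseˡ π ⟩
    l                      ∎
    where open ≡-Reasoning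

  ⟨$⟩ʳ-⟨$⟩ˡ : ∀ {i v} → toℕ i ≡ toℕ (π ⟨$⟩ˡ v) → π ⟨$⟩ʳ i ≡ v
  ⟨$⟩ʳ-⟨$⟩ˡ i≡π⁻¹v = trans (cong (π ⟨$⟩ʳ_) (Finₚ.toℕ-injective i≡π⁻¹v)) (inverseʳ π)

  inside⊎outside : ∀ (i j k : Fin n) → (i ≤ k × k ≤ j) ⊎ (k < i ⊎ j < k)
  inside⊎outside i j k with i Finₚ.≤? k | k Finₚ.≤? j
  ... | yes i≤k | yes k≤j = inj₁ (i≤k , k≤j)
  ... | no i≰k | _ = inj₂ (inj₁ (ℕₚ.≰⇒> i≰k))
  ... | yes _ | no k≰j = inj₂ (inj₂ (ℕₚ.≰⇒> k≰j))

  isInterval-ofValuesAbove : ∀ {i j} (t : Fin n) →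
    (∀ k → i ≤ k → k ≤ j → t < π ⟨$⟩ʳ k) → (∀ k → k < i ⊎ j < k → π ⟨$⟩ʳ k ≤ t) →
    IsInterval π i j
  isInterval-ofValuesAbove {i} {j} t inside outside k₁ _ v i≤k₁ k₁≤j _ _ πk₁≤v _
    with inside⊎outside i j (π ⟨$⟩ˡ v)
  ... | inj₁ (i≤k , k≤j) = π ⟨$⟩ˡ v , i≤k , k≤j , inverseʳ π
  ... | inj₂ out = contradiction (subst (_≤ t) (inverseʳ π) (outside _ out))
                     (ℕₚ.<⇒≱ (ℕₚ.<-≤-trans (inside k₁ i≤k₁ k₁≤j) πk₁≤v))

  isInterval-ofValuesBelow : ∀ {i j} (t : Fin n) →
    (∀ k → i ≤ k → k ≤ j → π ⟨$⟩ʳ k < t) → (∀ k → k < i ⊎ j < k → t ≤ π ⟨$⟩ʳ k) →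
    IsInterval π i j
  isInterval-ofValuesBelow {i} {j} t inside outside _ k₂ v _ _ i≤k₂ k₂≤j _ v≤πk₂
    with inside⊎outside i j (π ⟨$⟩ˡ v)
  ... | inj₁ (i≤k , k≤j) = π ⟨$⟩ˡ v , i≤k , k≤j , inverseʳ π
  ... | inj₂ out = contradiction (subst (t ≤_) (inverseʳ π) (outside _ out))
                     (ℕₚ.<⇒≱ (ℕₚ.≤-<-trans v≤πk₂ (inside k₂ i≤k₂ k₂≤j)))

module _ {N} (π : Perm (suc N)) (simple : IsSimple π) where

  isInterval⇒singleton : ∀ {i j} → i ≤ j → 0 ℕ.< toℕ i ⊎ toℕ j ℕ.< N → IsInterval π i j → i ≡ j
  isInterval⇒singleton {i} {j} i≤j proper interval with simple i j i≤j interval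
  ... | inj₁ length≡1 = Finₚ.≤-antisym i≤j (ℕₚ.m∸n≡0⇒m≤n (ℕₚ.suc-injective (begin
    suc (toℕ j ∸ toℕ i) ≡⟨ ℕₚ.+-∸-assoc 1 i≤j ⟨
    suc (toℕ j) ∸ toℕ i ≡⟨ length≡1 ⟩
    1                   ∎)))
    where open ≡-Reasoning
  ... | inj₂ length≡n = contradiction length≡n (ℕₚ.<⇒≢ (shorter proper))
    where
    shorter : 0 ℕ.< toℕ i ⊎ toℕ j ℕ.< N → suc (toℕ j) ∸ toℕ i ℕ.< suc N
    shorter (inj₁ 0<i) = ℕₚ.≤-<-trans (ℕₚ.∸-monoʳ-≤ (suc (toℕ j)) 0<i) (Finₚ.toℕ<n j)
    shorter (inj₂ j<N) = s≤s (ℕₚ.≤-trans (ℕₚ.m∸n≤m (suc (toℕ j)) (toℕ i)) j<N)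

  ¬isInterval-proper : ∀ {i j} → i < j → 0 ℕ.< toℕ i ⊎ toℕ j ℕ.< N → ¬ IsInterval π i j
  ¬isInterval-proper i<j proper interval =
    Finₚ.<-irrefl (isInterval⇒singleton (ℕₚ.<⇒≤ i<j) proper interval) i<j

argmax : ∀ {m} (h : Fin (suc m) → ℕ) → Σ (Fin (suc m)) λ α → ∀ k → h k ℕ.≤ h α
argmax {zero} h = zero , λ { zero → ℕₚ.≤-refl }
argmax {suc m} h with argmax (h ∘ suc)
... | α , max with h zero ℕₚ.≤? h (suc α)
...   | yes h₀≤ = suc α , λ { zero → h₀≤ ; (suc k) → max k }
...   | no h₀≰ = zero , λ { zero → ℕₚ.≤-refl ; (suc k) → ℕₚ.≤-trans (max k) (ℕₚ.<⇒≤ (ℕₚ.≰⇒> h₀≰)) }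

argmax-below : ∀ {n} (h : Fin n → ℕ) (q : Fin n) → 0 ℕ.< toℕ q →
  Σ (Fin n) λ α → α < q × (∀ k → k < q → h k ℕ.≤ h α)
argmax-below h (suc q) _ with argmax (h ∘ inject {i = suc q})
... | α , max =
  inject α , subst (ℕ._< suc (toℕ q)) (sym (Finₚ.toℕ-inject α)) (Finₚ.toℕ<n α) , bounded
  where
  bounded : ∀ k → k < suc q → h k ℕ.≤ h (inject α)
  bounded k k<q = subst (λ k′ → h k′ ℕ.≤ h (inject α)) injected (max (fromℕ< k<q))
    where
    injected : inject (fromℕ< k<q) ≡ k
    injected = Finₚ.toℕ-injective (trans (Finₚ.toℕ-inject _) (Finₚ.toℕ-fromℕ< k<q))

module SimpleAvoider {N} (π : Perm (suc (suc N))) (simple : IsSimple π)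
         (avoid2413 : ¬ ContainsPat π p2413) (avoid3412 : ¬ ContainsPat π p3412)
         (avoid3421 : ¬ ContainsPat π p3421) where

  last penultimate : Fin (suc (suc N))
  last = fromℕ (suc N)
  penultimate = inject₁ (fromℕ N)

  toℕ-penultimate : toℕ penultimate ≡ N
  toℕ-penultimate = trans (Finₚ.toℕ-inject₁ (fromℕ N)) (Finₚ.toℕ-fromℕ N)

  ≤penultimate⇒<last : ∀ {k : Fin (suc (suc N))} → k ≤ penultimate → k < last
  ≤penultimate⇒<last {k} k≤p = s≤s (subst (toℕ k ℕ.≤_) (Finₚ.toℕ-inject₁ (fromℕ N)) k≤p)

  penultimate<⇒≡last : ∀ {k} → penultimate < k → k ≡ last
  penultimate<⇒≡last {k} p<k = Finₚ.≤-antisym (Finₚ.≤fromℕ k)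
    (subst (λ x → suc x ℕ.≤ toℕ k) (Finₚ.toℕ-inject₁ (fromℕ N)) p<k)

  module _ {q α : Fin (suc (suc N))} (α<q : α < q) (πα<πq : π ⟨$⟩ʳ α < π ⟨$⟩ʳ q) where

    ¬twoBelowAfter : ∀ {k l} → q < k → k < l → π ⟨$⟩ʳ k < π ⟨$⟩ʳ α → π ⟨$⟩ʳ l < π ⟨$⟩ʳ α → ⊥
    ¬twoBelowAfter {k} {l} q<k k<l πk<πα πl<πα with Finₚ.<-cmp (π ⟨$⟩ʳ k) (π ⟨$⟩ʳ l)
    ... | tri< πk<πl _ _ = avoid3412 (contains3412 π α<q q<k k<l πk<πl πl<πα πα<πq)
    ... | tri≈ _ πk≡πl _ = Finₚ.<-irrefl (⟨$⟩ʳ-injective π πk≡πl) k<l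
    ... | tri> _ _ πl<πk = avoid3421 (contains3421 π α<q q<k k<l πl<πk πk<πα πα<πq)

    aboveFrom : ∀ k → q ≤ k → (q < k → π ⟨$⟩ʳ k < π ⟨$⟩ʳ α → ⊥) → π ⟨$⟩ʳ α < π ⟨$⟩ʳ k
    aboveFrom k q≤k ¬below with ℕₚ.m≤n⇒m<n∨m≡n q≤k
    ... | inj₂ q≡k = subst (λ k′ → π ⟨$⟩ʳ α < π ⟨$⟩ʳ k′) (Finₚ.toℕ-injective q≡k) πα<πq
    ... | inj₁ q<k with Finₚ.<-cmp (π ⟨$⟩ʳ k) (π ⟨$⟩ʳ α)
    ...   | tri< πk<πα _ _ = contradiction πk<πα (¬below q<k)
    ...   | tri≈ _ πk≡πα _ =
      contradiction (Finₚ.<-trans α<q q<k) (Finₚ.<-irrefl (sym (⟨$⟩ʳ-injective π πk≡πα)))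
    ...   | tri> _ _ πα<πk = πα<πk

  leftToRightMaximum⇒penultimate : ∀ q → 0 ℕ.< toℕ q → q < last →
    (∀ (k : Fin (suc (suc N))) → k < q → π ⟨$⟩ʳ k < π ⟨$⟩ʳ q) → π ⟨$⟩ʳ last < π ⟨$⟩ʳ q →
    toℕ q ≡ N × ∃ λ α → α < q × π ⟨$⟩ʳ last < π ⟨$⟩ʳ α
  leftToRightMaximum⇒penultimate q 0<q q<last before πlast<πq
    with argmax-below (toℕ ∘ (π ⟨$⟩ʳ_)) q 0<q
  ... | α , α<q , α-max with Finₚ.<-cmp (π ⟨$⟩ʳ last) (π ⟨$⟩ʳ α)
  ...   | tri< πlast<πα _ _ = q≡penultimate , α , α<q , πlast<πα
    where
    inside : ∀ k → q ≤ k → k ≤ penultimate → π ⟨$⟩ʳ α < π ⟨$⟩ʳ k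
    inside k q≤k k≤p = aboveFrom α<q (before α α<q) k q≤k λ q<k πk<πα →
      ¬twoBelowAfter α<q (before α α<q) q<k (≤penultimate⇒<last k≤p) πk<πα πlast<πα
    outside : ∀ k → k < q ⊎ penultimate < k → π ⟨$⟩ʳ k ≤ π ⟨$⟩ʳ α
    outside k (inj₁ k<q) = α-max k k<q
    outside k (inj₂ p<k) rewrite penultimate<⇒≡last p<k = ℕₚ.<⇒≤ πlast<πα
    q≡penultimate : toℕ q ≡ N
    q≡penultimate = trans (cong toℕ (isInterval⇒singleton π simple (Finₚ.<⇒≤pred q<last) (inj₁ 0<q)
                                       (isInterval-ofValuesAbove π (π ⟨$⟩ʳ α) inside outside)))
                          toℕ-penultimate
  ...   | tri≈ _ πlast≡πα _ = contradiction (⟨$⟩ʳ-injective π πlast≡πα)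
                              λ last≡α → Finₚ.<-irrefl (sym last≡α) (Finₚ.<-trans α<q q<last)
  ...   | tri> _ _ πα<πlast = contradiction (isInterval-ofValuesAbove π (π ⟨$⟩ʳ α) inside outside)
                              (¬isInterval-proper π simple q<last (inj₁ 0<q))
    where
    inside : ∀ k → q ≤ k → k ≤ last → π ⟨$⟩ʳ α < π ⟨$⟩ʳ k
    inside k q≤k k≤last = aboveFrom α<q (before α α<q) k q≤k λ q<k πk<πα →
      [ (λ k<last → avoid2413 (contains2413 π α<q q<k k<last πk<πα πα<πlast πlast<πq))
      , (λ k≡last → Finₚ.<-asym πα<πlast
           (subst (λ k′ → π ⟨$⟩ʳ k′ < π ⟨$⟩ʳ α) (Finₚ.toℕ-injective k≡last) πk<πα)) ]
      (ℕₚ.m≤n⇒m<n∨m≡n k≤last)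
    outside : ∀ k → k < q ⊎ last < k → π ⟨$⟩ʳ k ≤ π ⟨$⟩ʳ α
    outside k (inj₁ k<q) = α-max k k<q
    outside k (inj₂ last<k) = contradiction (Finₚ.≤fromℕ k) (ℕₚ.<⇒≱ last<k)

module LargestValues {N} (π : Perm (suc (suc (suc N)))) (simple : IsSimple π)
         (avoid2413 : ¬ ContainsPat π p2413) (avoid3412 : ¬ ContainsPat π p3412)
         (avoid3421 : ¬ ContainsPat π p3421) where

  open SimpleAvoider π simple avoid2413 avoid3412 avoid3421 public

  maxPosition secondPosition : Fin (suc (suc (suc N)))
  maxPosition = π ⟨$⟩ˡ last
  secondPosition = π ⟨$⟩ˡ penultimate

  ≢maxPosition⇒<last : ∀ {k} → k ≢ maxPosition → π ⟨$⟩ʳ k < last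
  ≢maxPosition⇒<last k≢m =
    Finₚ.≤∧≢⇒< (Finₚ.≤fromℕ _) λ πk≡last → k≢m (trans (sym (inverseˡ π)) (cong (π ⟨$⟩ˡ_) πk≡last))

  0<maxPosition : 0 ℕ.< toℕ maxPosition
  0<maxPosition = ℕₚ.n≢0⇒n>0 λ m≡0 →
    ¬isInterval-proper π simple {suc zero} {last} (s≤s (s≤s z≤n)) (inj₁ (s≤s z≤n))
      (isInterval-ofValuesBelow π last (inside m≡0) (outside m≡0))
    where
    inside : toℕ maxPosition ≡ 0 → ∀ k → 0 ℕ.< toℕ k → k ≤ last → π ⟨$⟩ʳ k < last
    inside m≡0 k 1≤k _ = ≢maxPosition⇒<last λ k≡m → ℕₚ.<⇒≢ 1≤k (sym (trans (cong toℕ k≡m) m≡0))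
    outside : toℕ maxPosition ≡ 0 → ∀ k → toℕ k ℕ.< 1 ⊎ last < k → last ≤ π ⟨$⟩ʳ k
    outside m≡0 k (inj₁ k<1) =
      ℕₚ.≤-reflexive (cong toℕ (sym (⟨$⟩ʳ-⟨$⟩ˡ π (trans (ℕₚ.n<1⇒n≡0 k<1) (sym m≡0)))))
    outside m≡0 k (inj₂ last<k) = contradiction (Finₚ.≤fromℕ k) (ℕₚ.<⇒≱ last<k)

  maxPosition<last : maxPosition < last
  maxPosition<last = Finₚ.≤∧≢⇒< (Finₚ.≤fromℕ _) λ m≡last →
    ¬isInterval-proper π simple {zero} {penultimate} (s≤s z≤n)
      (inj₂ (ℕₚ.≤-reflexive (cong suc toℕ-penultimate)))
      (isInterval-ofValuesBelow π last (inside m≡last) (outside m≡last))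
    where
    inside : maxPosition ≡ last → ∀ k → 0 ℕ.≤ toℕ k → k ≤ penultimate → π ⟨$⟩ʳ k < last
    inside m≡last k _ k≤p = ≢maxPosition⇒<last λ k≡m →
      Finₚ.<-irrefl (trans k≡m m≡last) (≤penultimate⇒<last k≤p)
    outside : maxPosition ≡ last → ∀ k → toℕ k ℕ.< 0 ⊎ penultimate < k → last ≤ π ⟨$⟩ʳ k
    outside m≡last k (inj₂ p<k) =
      ℕₚ.≤-reflexive (cong toℕ (sym (⟨$⟩ʳ-⟨$⟩ˡ π
        (cong toℕ (trans (penultimate<⇒≡last p<k) (sym m≡last))))))

  maxPosition-isPenultimate :
    toℕ maxPosition ≡ suc N × ∃ λ α → α < maxPosition × π ⟨$⟩ʳ last < π ⟨$⟩ʳ α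
  maxPosition-isPenultimate =
    leftToRightMaximum⇒penultimate maxPosition 0<maxPosition maxPosition<last
      (λ k k<m → below-max (Finₚ.<⇒≢ k<m))
      (below-max (λ last≡m → Finₚ.<-irrefl (sym last≡m) maxPosition<last))
    where
    below-max : ∀ {k} → k ≢ maxPosition → π ⟨$⟩ʳ k < π ⟨$⟩ʳ maxPosition
    below-max k≢m = subst (π ⟨$⟩ʳ _ <_) (sym (inverseʳ π)) (≢maxPosition⇒<last k≢m)

  secondPosition≡first : toℕ secondPosition ≡ 0
  secondPosition≡first with maxPosition-isPenultimate
  ... | m≡N , α , α<m , πlast<πα = ℕₚ.n≤0⇒n≡0 (ℕₚ.≮⇒≥ λ 0<s →
          Finₚ.<-irrefl (Finₚ.toℕ-injective (trans (proj₁ (0<secondPosition⇒penultimate 0<s)) (sym m≡N)))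
                        s<m)
    where
    πs≡p : π ⟨$⟩ʳ secondPosition ≡ penultimate
    πs≡p = inverseʳ π
    πlast<p : π ⟨$⟩ʳ last < penultimate
    πlast<p = ℕₚ.<-≤-trans πlast<πα (Finₚ.<⇒≤pred (≢maxPosition⇒<last (Finₚ.<⇒≢ α<m)))
    below-second : ∀ {k} → k ≢ maxPosition → k ≢ secondPosition → π ⟨$⟩ʳ k < π ⟨$⟩ʳ secondPosition
    below-second {k} k≢m k≢s = subst (π ⟨$⟩ʳ k <_) (sym πs≡p)
      (Finₚ.≤∧≢⇒< (Finₚ.<⇒≤pred (≢maxPosition⇒<last k≢m))
                   λ πk≡p → k≢s (trans (sym (inverseˡ π)) (cong (π ⟨$⟩ˡ_) πk≡p)))
    s≢last : secondPosition ≢ last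
    s≢last s≡last = Finₚ.<-irrefl (trans (cong (π ⟨$⟩ʳ_) (sym s≡last)) πs≡p) πlast<p
    s<m : secondPosition < maxPosition
    s<m = Finₚ.≤∧≢⇒<
      (subst (toℕ secondPosition ℕ.≤_) (trans toℕ-penultimate (sym m≡N))
             (Finₚ.<⇒≤pred (Finₚ.≤∧≢⇒< (Finₚ.≤fromℕ _) s≢last)))
      λ s≡m → Finₚ.fromℕ≢inject₁ (trans (sym (inverseʳ π)) (trans (cong (π ⟨$⟩ʳ_) (sym s≡m)) πs≡p))
    0<secondPosition⇒penultimate : 0 ℕ.< toℕ secondPosition →
      toℕ secondPosition ≡ suc N × ∃ λ β → β < secondPosition × π ⟨$⟩ʳ last < π ⟨$⟩ʳ β
    0<secondPosition⇒penultimate 0<s = leftToRightMaximum⇒penultimate secondPosition 0<s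
      (Finₚ.<-trans s<m maxPosition<last)
      (λ k k<s → below-second (Finₚ.<⇒≢ (Finₚ.<-trans k<s s<m)) (Finₚ.<⇒≢ k<s))
      (subst (π ⟨$⟩ʳ last <_) (sym πs≡p) πlast<p)

mainTheorem20 : (n : ℕ) (π : Perm n) → n ≥ 4 → IsSimple π →
    ¬ ContainsPat π p2413 → ¬ ContainsPat π p3412 → ¬ ContainsPat π p3421 →
    ((∀ (i : Fin n) → toℕ i ≡ n ∸ 2 → toℕ (π ⟨$⟩ʳ i) ≡ n ∸ 1)
    × (∀ (i : Fin n) → toℕ i ≡ 0 → toℕ (π ⟨$⟩ʳ i) ≡ n ∸ 2))
mainTheorem20 _ π (s≤s (s≤s (s≤s _))) simple avoid2413 avoid3412 avoid3421 =
  (λ i i≡m → trans (cong toℕ (⟨$⟩ʳ-⟨$⟩ˡ π (trans i≡m (sym (proj₁ maxPosition-isPenultimate)))))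
                   (Finₚ.toℕ-fromℕ _)) ,
  (λ i i≡s → trans (cong toℕ (⟨$⟩ʳ-⟨$⟩ˡ π (trans i≡s (sym secondPosition≡first))))
                   toℕ-penultimate)
  where
  open LargestValues π simple avoid2413 avoid3412 avoid3421
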